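{- Let $\mathcal{F}\colon\mathsf{X}\to\mathsf{Y}$ be a non-trivial left adjoint functor between generalized quasi-varieties. Then the universe of $\mathcal{F}(\mathbf{Tm}_{\mathsf{X}}(1))$ is non-empty.
   Context: A generalized quasi-variety is a class of algebras axiomatized by a set of generalized quasi-equations $(\bigwedge_{i\in I}\alpha_i\approx\beta_i)\to\varphi\approx\psi$ ($I$ possibly infinite) whose number of variables is bounded by an infinite cardinal; it is viewed as a category with homomorphisms as arrows, and if its language has no constant symbols the empty algebra is included as an object. $\mathbf{Tm}_{\mathsf{X}}(1)$ is the free algebra of $\mathsf{X}$ on one generator. A left adjoint functor between generalized quasi-varieties is trivial if it sends every object to the initial object. -}

module Defs where

open import Level using (Level; _⊔_) renaming (suc to lsuc)
open import Data.Nat using (ℕ)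
open import Data.Fin using (Fin)
open import Data.Product using (Σ; _×_)
open import Relation.Binary.PropositionalEquality using (_≡_)
open import Relation.Nullary using (¬_)
open import Data.Empty using (⊥)

record Signature (ℓ : Level) : Set (lsuc ℓ) where
  field
    Op    : Set ℓ
    arity : Op → ℕ

module _ {ℓ : Level} (Σs : Signature ℓ) where
  open Signature Σs

  data Term {v : Level} (V : Set v) : Set (ℓ ⊔ v) where
    var : V → Term V
    app : (o : Op) → (Fin (arity o) → Term V) → Term V

  record Algebra (a : Level) : Set (ℓ ⊔ lsuc a) where
    field
      Carrier : Set a
      ⟦_⟧     : (o : Op) → (Fin (arity o) → Carrier) → Carrier

  module _ {a v : Level} (A : Algebra a) {V : Set v} where
    open Algebra A
    eval : (V → Carrier) → Term V → Carrier
    eval ρ (var x)    = ρ x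
    eval ρ (app o ts) = ⟦ o ⟧ (λ i → eval ρ (ts i))

  record GQEquation (V : Set ℓ) : Set (lsuc ℓ) where
    field
      I    : Set ℓ
      α β  : I → Term V
      φ ψ  : Term V

-- A generalized quasi-variety, presented by its axiomatization: a language,
-- a set of variables (of size bounded by some infinite cardinal) and a set
-- of generalized quasi-equations in these variables.
record GQV (ℓ : Level) : Set (lsuc ℓ) where
  field
    sig  : Signature ℓ
    Var  : Set ℓ
    Ax   : Set ℓ
    axiom : Ax → GQEquation sig Var

module _ {ℓ : Level} (X : GQV ℓ) where
  open GQV X

  -- Objects of the category X: algebras satisfying all axioms
  -- (the empty algebra is included whenever it exists, i.e. no constants).
  record Model (a : Level) : Set (lsuc ℓ ⊔ lsuc a) where
    field
      alg : Algebra sig a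
    open Algebra alg public
    field
      sat : (k : Ax) → let open GQEquation (axiom k) in
            (ρ : Var → Carrier) →
            ((i : I) → eval sig alg ρ (α i) ≡ eval sig alg ρ (β i)) →
            eval sig alg ρ φ ≡ eval sig alg ρ ψ

module _ {ℓ : Level} {X : GQV ℓ} where
  open GQV X
  open Signature sig

  record Hom {a b : Level} (A : Model X a) (B : Model X b) : Set (ℓ ⊔ a ⊔ b) where
    private
      module A = Model A
      module B = Model B
    field
      fun : A.Carrier → B.Carrier
      hom : (o : Op) (xs : Fin (arity o) → A.Carrier) →
            fun (A.⟦ o ⟧ xs) ≡ B.⟦ o ⟧ (λ i → fun (xs i))
  open Hom public

  _≈h_ : {a b : Level} {A : Model X a} {B : Model X b} → Hom A B → Hom A B → Set (a ⊔ b)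
  _≈h_ {A = A} f g = (x : Model.Carrier A) → fun f x ≡ fun g x

  idH : {a : Level} {A : Model X a} → Hom A A
  idH = record { fun = λ x → x ; hom = λ o xs → Relation.Binary.PropositionalEquality.refl }

  _∘H_ : {a b c : Level} {A : Model X a} {B : Model X b} {C : Model X c} →
         Hom B C → Hom A B → Hom A C
  _∘H_ {A = A} {B} {C} g f = record
    { fun = λ x → fun g (fun f x)
    ; hom = λ o xs → Relation.Binary.PropositionalEquality.trans
              (Relation.Binary.PropositionalEquality.cong (fun g) (hom f o xs))
              (hom g o (λ i → fun f (xs i))) }

  IsInitial : {a : Level} → Model X a → Set (lsuc ℓ ⊔ lsuc a)
  IsInitial {a} I = (B : Model X a) → Σ (Hom I B) (λ h → (h' : Hom I B) → h' ≈h h)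

  -- T is free on one generator g (this is Tm_X(1), up to isomorphism).
  IsFreeOn1 : {a : Level} (T : Model X a) → Model.Carrier T → Set (lsuc ℓ ⊔ lsuc a)
  IsFreeOn1 {a} T g = (A : Model X a) (x : Model.Carrier A) →
    Σ (Hom T A) (λ h → (fun h g ≡ x) × ((h' : Hom T A) → fun h' g ≡ x → h' ≈h h))

record Functor {ℓx ℓy : Level} (X : GQV ℓx) (Y : GQV ℓy) (a b : Level)
       : Set (lsuc ℓx ⊔ lsuc ℓy ⊔ lsuc a ⊔ lsuc b) where
  field
    F₀      : Model X a → Model Y b
    F₁      : {A B : Model X a} → Hom A B → Hom (F₀ A) (F₀ B)
    F-id    : {A : Model X a} → F₁ (idH {A = A}) ≈h idH
    F-∘     : {A B C : Model X a} (g : Hom B C) (f : Hom A B) →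
              F₁ (g ∘H f) ≈h (F₁ g ∘H F₁ f)
    F-resp  : {A B : Model X a} {f g : Hom A B} → f ≈h g → F₁ f ≈h F₁ g

-- F is a left adjoint: it has a right adjoint G, given by couniversal arrows
-- ε_B : F(G B) → B (for every f : F A → B there is a unique g : A → G B with
-- ε_B ∘ F g = f).
record IsLeftAdjoint {ℓx ℓy a b : Level} {X : GQV ℓx} {Y : GQV ℓy}
       (F : Functor X Y a b) : Set (lsuc ℓx ⊔ lsuc ℓy ⊔ lsuc a ⊔ lsuc b) where
  open Functor F
  field
    G₀     : Model Y b → Model X a
    ε      : (B : Model Y b) → Hom (F₀ (G₀ B)) B
    lift   : {A : Model X a} {B : Model Y b} → Hom (F₀ A) B → Hom A (G₀ B)
    lift-β : {A : Model X a} {B : Model Y b} (f : Hom (F₀ A) B) →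
             (ε B ∘H F₁ (lift f)) ≈h f
    lift-η : {A : Model X a} {B : Model Y b} (f : Hom (F₀ A) B) (g : Hom A (G₀ B)) →
             (ε B ∘H F₁ g) ≈h f → g ≈h lift f

IsTrivial : {ℓx ℓy a b : Level} {X : GQV ℓx} {Y : GQV ℓy} →
            Functor X Y a b → Set (lsuc ℓx ⊔ lsuc ℓy ⊔ lsuc a ⊔ lsuc b)
IsTrivial {X = X} F = (A : Model X _) → IsInitial (Functor.F₀ F A)

{-# OPTIONS --safe #-}
module Submission where

open import Defs
open import Level using (Level)
open import Data.Empty using (⊥; ⊥-elim)
open import Relation.Nullary using (¬_)
open import Data.Product using (Σ; _,_; proj₁; proj₂)
open import Relation.Binary.PropositionalEquality using (_≡_; sym; trans; cong)
open Relation.Binary.PropositionalEquality.≡-Reasoning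

-- If F(T) were empty it would be initial, so by adjointness T would have
-- exactly one arrow into every G(B); as T is free on one generator, each G(B)
-- is then a one-point algebra. Every A has exactly one arrow into a one-point
-- algebra, so by adjointness again every F(A) is initial, i.e. F is trivial.

module _ {ℓ : Level} {X : GQV ℓ} where

  empty⇒IsInitial : {a : Level} {A : Model X a} → ¬ Model.Carrier A → IsInitial A
  empty⇒IsInitial {A = A} empty B =
    record { fun = λ x → ⊥-elim (empty x)
           ; hom = λ o xs → ⊥-elim (empty (Model.⟦_⟧ A o xs)) }
    , λ _ x → ⊥-elim (empty x)

  IsSubsingleton : {a : Level} → Model X a → Set a
  IsSubsingleton C = (x y : Model.Carrier C) → x ≡ y

  constHom : {a c : Level} {A : Model X a} {C : Model X c} →
             IsSubsingleton C → Model.Carrier C → Hom A C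
  constHom sub c = record { fun = λ _ → c ; hom = λ _ _ → sub _ _ }

  free-on-1-detects-subsingleton : {a : Level} {T C : Model X a} {g : Model.Carrier T} →
    IsFreeOn1 T g → ((h h' : Hom T C) → h ≈h h') → IsSubsingleton C
  free-on-1-detects-subsingleton {T = T} {C} {g} free homs-agree x y =
    begin
      x             ≡⟨ sym (proj₁ (proj₂ (free C x))) ⟩
      fun hx g      ≡⟨ homs-agree hx hy g ⟩
      fun hy g      ≡⟨ proj₁ (proj₂ (free C y)) ⟩
      y             ∎
    where
    hx hy : Hom T C
    hx = proj₁ (free C x)
    hy = proj₁ (free C y)

module _ {ℓx ℓy a b : Level} {X : GQV ℓx} {Y : GQV ℓy}
         (F : Functor X Y a b) (adj : IsLeftAdjoint F) where
  open Functor F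
  open IsLeftAdjoint adj

  F₀-initial⇒Hom-unique : {A : Model X a} → IsInitial (F₀ A) →
    (B : Model Y b) (g g' : Hom A (G₀ B)) → g ≈h g'
  F₀-initial⇒Hom-unique {A} initial B g g' x =
    trans (lift-η f g (proj₂ (initial B) (ε B ∘H F₁ g)) x)
          (sym (lift-η f g' (proj₂ (initial B) (ε B ∘H F₁ g')) x))
    where
    f : Hom (F₀ A) B
    f = proj₁ (initial B)

  Hom-contractible⇒F₀-initial : {A : Model X a} →
    ((B : Model Y b) → Σ (Hom A (G₀ B)) λ k → (g : Hom A (G₀ B)) → g ≈h k) →
    IsInitial (F₀ A)
  Hom-contractible⇒F₀-initial {A} contr B = ε B ∘H F₁ k , uniq
    where
    k : Hom A (G₀ B)
    k = proj₁ (contr B)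
    uniq : (h : Hom (F₀ A) B) → h ≈h (ε B ∘H F₁ k)
    uniq h z = trans (sym (lift-β h z))
                     (cong (fun (ε B)) (F-resp (proj₂ (contr B) (lift h)) z))

lemma4p1 : {ℓx ℓy a b : Level} {X : GQV ℓx} {Y : GQV ℓy}
           (F : Functor X Y a b) → IsLeftAdjoint F → ¬ IsTrivial F →
           (T : Model X a) (g : Model.Carrier T) → IsFreeOn1 T g →
           ¬ (Model.Carrier (Functor.F₀ F T) → ⊥)
lemma4p1 F adj nontrivial T g free empty =
  nontrivial λ A → Hom-contractible⇒F₀-initial F adj λ B →
    let sub = G₀B-subsingleton B
    in constHom sub (point B) , λ _ _ → sub _ _
  where
  open IsLeftAdjoint adj

  F₀T-initial : IsInitial (Functor.F₀ F T)
  F₀T-initial = empty⇒IsInitial empty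

  G₀B-subsingleton : (B : Model _ _) → IsSubsingleton (G₀ B)
  G₀B-subsingleton B = free-on-1-detects-subsingleton free
    (F₀-initial⇒Hom-unique F adj F₀T-initial B)

  point : (B : Model _ _) → Model.Carrier (G₀ B)
  point B = fun (lift (proj₁ (F₀T-initial B))) g
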